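{- Let $a_1,\dots,a_n\in\mathbb{C}\setminus\{0\}$, $b_1,\dots,b_n\in\mathbb{C}$, and let $A=v_1v_1^*+v_2v_2^*$ where $v_1=(a_1,\dots,a_n)^T$ and $v_2=(b_1,\dots,b_n)^T$. Let $A'=v_3v_3^*+v_4v_4^*$ where $v_3=(1,\dots,1)^T$ and $v_4=(b_1/a_1,\dots,b_n/a_n)^T$. Then $\pi(A)=\prod_{i=1}^n|a_i|^2\,\pi(A')$.
   Context: For an $n\times n$ matrix $B=(b_{ij})$, the Schur power matrix $\pi(B)$ is the $n!\times n!$ matrix indexed by pairs $\sigma,\tau\in S_n$ with $(\sigma,\tau)$ entry $\prod_{i=1}^n b_{\sigma(i)\tau(i)}$. -}

module Defs where

open import Level using (_⊔_; suc)
open import Data.Nat using (ℕ)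
open import Data.Fin using (Fin)
open import Data.Fin.Permutation using (Permutation′; _⟨$⟩ʳ_)
open import Algebra.Bundles using (CommutativeRing)
open import Relation.Nullary using (¬_)

-- A field equipped with a conjugation (an involutive ring automorphism),
-- the abstract algebraic setting of (ℂ, complex conjugation).
record InvolutiveField c ℓ : Set (Level.suc (c ⊔ ℓ)) where
  field
    commutativeRing : CommutativeRing c ℓ
  open CommutativeRing commutativeRing public
  field
    _⁻¹       : Carrier → Carrier
    0≉1       : ¬ (0# ≈ 1#)
    ⁻¹-inverse : ∀ x → ¬ (x ≈ 0#) → x * (x ⁻¹) ≈ 1#
    conj      : Carrier → Carrier
    conj-cong : ∀ {x y} → x ≈ y → conj x ≈ conj y
    conj-+    : ∀ x y → conj (x + y) ≈ conj x + conj y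
    conj-*    : ∀ x y → conj (x * y) ≈ conj x * conj y
    conj-1    : conj 1# ≈ 1#
    conj-invol : ∀ x → conj (conj x) ≈ x

module Over {c ℓ} (F : InvolutiveField c ℓ) where
  open InvolutiveField F hiding (zero)

  Matrix : ℕ → Set c
  Matrix n = Fin n → Fin n → Carrier

  ∏ : ∀ {n} → (Fin n → Carrier) → Carrier
  ∏ {ℕ.zero}  f = 1#
  ∏ {ℕ.suc n} f = f Fin.zero * ∏ (λ i → f (Fin.suc i))

  _÷_ : Carrier → Carrier → Carrier
  x ÷ y = x * (y ⁻¹)

  ∣_∣² : Carrier → Carrier
  ∣ x ∣² = x * conj x

  gram₂ : ∀ {n} → (Fin n → Carrier) → (Fin n → Carrier) → Matrix n
  gram₂ v u i j = v i * conj (v j) + u i * conj (u j)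

  -- Schur power matrix π(B), indexed by pairs of permutations
  schurPower : ∀ {n} → Matrix n → Permutation′ n → Permutation′ n → Carrier
  schurPower B σ τ = ∏ (λ i → B (σ ⟨$⟩ʳ i) (τ ⟨$⟩ʳ i))

module Submission where

open import Defs
open import Data.Nat using (ℕ)
open import Data.Fin using (Fin)
open import Data.Fin.Permutation using (Permutation′; _⟨$⟩ʳ_)
open import Relation.Nullary using (¬_)
import Algebra.Properties.CommutativeMonoid.Sum as CommutativeMonoidSum
import Algebra.Properties.CommutativeSemigroup as CommutativeSemigroupProperties
import Relation.Binary.Reasoning.Setoid as SetoidReasoning

-- Scaling the i-th coordinate of both vectors by a i turns A′ into A, entrywise
-- A p q = a p conj(a q) A′ p q; along the diagonal (σ i, τ i) of a Schur power
-- these factors multiply to ∏ a σ · ∏ conj (a τ), which is ∏ ∣ a ∣² since σ and τ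
-- only reorder the product.

module _ {c ℓ} (F : InvolutiveField c ℓ) where
  open InvolutiveField F
  open Over F
  open CommutativeMonoidSum *-commutativeMonoid using (sum; sum-cong-≋; ∑-distrib-+; sum-permute)
  open CommutativeSemigroupProperties *-commutativeSemigroup using (interchange)
  open SetoidReasoning setoid

  ∏≈sum : ∀ {n} (f : Fin n → Carrier) → ∏ f ≈ sum f
  ∏≈sum {ℕ.zero}  f = refl
  ∏≈sum {ℕ.suc n} f = *-congˡ (∏≈sum (λ i → f (Fin.suc i)))

  ∏-cong : ∀ {n} {f g : Fin n → Carrier} → (∀ i → f i ≈ g i) → ∏ f ≈ ∏ g
  ∏-cong {f = f} {g} f≈g = begin
    ∏ f   ≈⟨ ∏≈sum f ⟩
    sum f ≈⟨ sum-cong-≋ f≈g ⟩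
    sum g ≈⟨ ∏≈sum g ⟨
    ∏ g   ∎

  ∏-distrib-* : ∀ {n} (f g : Fin n → Carrier) → ∏ (λ i → f i * g i) ≈ ∏ f * ∏ g
  ∏-distrib-* f g = begin
    ∏ (λ i → f i * g i)   ≈⟨ ∏≈sum (λ i → f i * g i) ⟩
    sum (λ i → f i * g i) ≈⟨ ∑-distrib-+ f g ⟩
    sum f * sum g         ≈⟨ *-cong (∏≈sum f) (∏≈sum g) ⟨
    ∏ f * ∏ g             ∎

  ∏-permute : ∀ {n} (f : Fin n → Carrier) (π : Permutation′ n) → ∏ (λ i → f (π ⟨$⟩ʳ i)) ≈ ∏ f
  ∏-permute f π = begin
    ∏ (λ i → f (π ⟨$⟩ʳ i))   ≈⟨ ∏≈sum (λ i → f (π ⟨$⟩ʳ i)) ⟩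
    sum (λ i → f (π ⟨$⟩ʳ i)) ≈⟨ sum-permute f π ⟨
    sum f                    ≈⟨ ∏≈sum f ⟨
    ∏ f                      ∎

  *-÷-cancel : ∀ {x} y → ¬ (x ≈ 0#) → x * (y ÷ x) ≈ y
  *-÷-cancel {x} y x≉0 = begin
    x * (y * x ⁻¹) ≈⟨ *-congˡ (*-comm y (x ⁻¹)) ⟩
    x * (x ⁻¹ * y) ≈⟨ *-assoc x (x ⁻¹) y ⟨
    x * x ⁻¹ * y   ≈⟨ *-congʳ (⁻¹-inverse x x≉0) ⟩
    1# * y         ≈⟨ *-identityˡ y ⟩
    y              ∎

  gram₂-cong : ∀ {n} {v v′ u u′ : Fin n → Carrier} →
               (∀ i → v i ≈ v′ i) → (∀ i → u i ≈ u′ i) → ∀ p q → gram₂ v u p q ≈ gram₂ v′ u′ p q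
  gram₂-cong v≈v′ u≈u′ p q =
    +-cong (*-cong (v≈v′ p) (conj-cong (v≈v′ q))) (*-cong (u≈u′ p) (conj-cong (u≈u′ q)))

  gram₂-scale : ∀ {n} (d v u : Fin n → Carrier) p q →
                gram₂ (λ i → d i * v i) (λ i → d i * u i) p q ≈ d p * conj (d q) * gram₂ v u p q
  gram₂-scale d v u p q = begin
    d p * v p * conj (d q * v q) + d p * u p * conj (d q * u q)
      ≈⟨ +-cong (*-congˡ (conj-* (d q) (v q))) (*-congˡ (conj-* (d q) (u q))) ⟩
    d p * v p * (conj (d q) * conj (v q)) + d p * u p * (conj (d q) * conj (u q))
      ≈⟨ +-cong (interchange _ _ _ _) (interchange _ _ _ _) ⟩
    d p * conj (d q) * (v p * conj (v q)) + d p * conj (d q) * (u p * conj (u q))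
      ≈⟨ distribˡ (d p * conj (d q)) _ _ ⟨
    d p * conj (d q) * gram₂ v u p q ∎

  schurPower-scale : ∀ {n} (d : Fin n → Carrier) (B : Matrix n) (σ τ : Permutation′ n) →
                     schurPower (λ p q → d p * conj (d q) * B p q) σ τ
                       ≈ ∏ (λ i → ∣ d i ∣²) * schurPower B σ τ
  schurPower-scale d B σ τ = begin
    ∏ (λ i → d (σ ⟨$⟩ʳ i) * conj (d (τ ⟨$⟩ʳ i)) * B (σ ⟨$⟩ʳ i) (τ ⟨$⟩ʳ i))
      ≈⟨ ∏-distrib-* (λ i → d (σ ⟨$⟩ʳ i) * conj (d (τ ⟨$⟩ʳ i))) (λ i → B (σ ⟨$⟩ʳ i) (τ ⟨$⟩ʳ i)) ⟩
    ∏ (λ i → d (σ ⟨$⟩ʳ i) * conj (d (τ ⟨$⟩ʳ i))) * schurPower B σ τ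
      ≈⟨ *-congʳ (∏-distrib-* (λ i → d (σ ⟨$⟩ʳ i)) (λ i → conj (d (τ ⟨$⟩ʳ i)))) ⟩
    ∏ (λ i → d (σ ⟨$⟩ʳ i)) * ∏ (λ i → conj (d (τ ⟨$⟩ʳ i))) * schurPower B σ τ
      ≈⟨ *-congʳ (*-cong (∏-permute d σ) (∏-permute (λ i → conj (d i)) τ)) ⟩
    ∏ d * ∏ (λ i → conj (d i)) * schurPower B σ τ
      ≈⟨ *-congʳ (∏-distrib-* d (λ i → conj (d i))) ⟨
    ∏ (λ i → ∣ d i ∣²) * schurPower B σ τ ∎

proposition3p1 : ∀ {c ℓ} (F : InvolutiveField c ℓ) (n : ℕ)
                   (a b : Fin n → InvolutiveField.Carrier F) →
                   (∀ i → ¬ (InvolutiveField._≈_ F (a i) (InvolutiveField.0# F))) →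
                   let open InvolutiveField F
                       open Over F
                       A  = gram₂ a b
                       A′ = gram₂ (λ _ → 1#) (λ i → b i ÷ a i)
                   in ∀ (σ τ : Permutation′ n) →
                        schurPower A σ τ ≈ ∏ (λ i → ∣ a i ∣²) * schurPower A′ σ τ
proposition3p1 F n a b a≉0 σ τ =
  trans (∏-cong F (λ i → A≈scaledA′ (σ ⟨$⟩ʳ i) (τ ⟨$⟩ʳ i))) (schurPower-scale F a A′ σ τ)
  where
    open InvolutiveField F
    open Over F
    A′ = gram₂ (λ _ → 1#) (λ i → b i ÷ a i)

    A≈scaledA′ : ∀ p q → gram₂ a b p q ≈ a p * conj (a q) * A′ p q
    A≈scaledA′ p q =
      trans (gram₂-cong F (λ i → sym (*-identityʳ (a i))) (λ i → sym (*-÷-cancel F (b i) (a≉0 i))) p q)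
            (gram₂-scale F a (λ _ → 1#) (λ i → b i ÷ a i) p q)
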